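{- For a cache of size $M\ge 2n$, there exists an execution of the prototype dynamic programming algorithm $\mathcal{A}^*$ on an input of size $n$ (with recomputation of intermediate values allowed) that performs $\mathcal{O}(n/B)$ I/O operations, where each I/O operation moves up to $B$ memory words stored in consecutive locations between cache and slow memory.
   Context: Prototype algorithm $\mathcal{A}^*$: given an input of size $n$, set $S(i,i)$ to an initialization value for $i=1,\dots,n$; then for $\ell=2,\dots,n$ and $i=1,\dots,n-\ell+1$, with $j=i+\ell-1$, set $S(i,j)$ to a least-optimal value and for $k=i,\dots,j-1$ update $S(i,j)\leftarrow \mathrm{AGGREGATE}(S(i,j),\mathrm{COMBINE}(S(i,k),S(k+1,j)))$, where AGGREGATE is commutative and associative; the output is $S(1,n)$. Each value $S(i,j)$ and each intermediate result occupies one memory word, and COMBINE and AGGREGATE are unit-time operations. Memory model: a cache of $M$ words and an unbounded slow memory; an operation can be executed only when its operands are in cache; inputs are initially in slow memory; a read/write I/O operation moves up to $B$ consecutive words between slow memory and cache. -}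

module Defs where

open import Data.Nat using (ℕ; zero; suc; _+_; _*_; _∸_; _≤_; _<_; _≟_)
open import Data.List using (List; []; _∷_; _++_; length; upTo; map; catMaybes)
open import Data.List.Membership.Propositional using (_∈_)
open import Data.List.Relation.Unary.All using (All)
open import Data.Maybe using (Maybe; just; nothing)
open import Data.Product using (_×_; ∃-syntax)
open import Relation.Binary.PropositionalEquality using (_≡_)
open import Relation.Nullary using (yes; no)
open import Relation.Nullary.Decidable using (⌊_⌋)
open import Data.Bool using (if_then_else_)

-- Computational DAG of the prototype algorithm A* on an input of size n.
-- Indices i, j, k are 1-based as in the paper.
--
--   leaf i       : S(i,i), the i-th input (initialization value); it is
--                  an input, initially stored in slow memory, not computed.
--   acc i j m    : the value held in S(i,j) (i < j) after the first m
--                  AGGREGATE updates; acc i j 0 is the least-optimal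
--                  value and acc i j (j ∸ i) is the final S(i,j).
--   comb i k j   : COMBINE(S(i,k), S(k+1,j)).

data Node : Set where
  leaf : ℕ → Node
  acc  : ℕ → ℕ → ℕ → Node
  comb : ℕ → ℕ → ℕ → Node

S : ℕ → ℕ → Node
S i j with i ≟ j
... | yes _ = leaf i
... | no  _ = acc i j (j ∸ i)

data Rule (n : ℕ) : Node → List Node → Set where
  init-rule : ∀ {i j} → 1 ≤ i → i < j → j ≤ n →
              Rule n (acc i j 0) []
  comb-rule : ∀ {i k j} → 1 ≤ i → i ≤ k → k < j → j ≤ n →
              Rule n (comb i k j) (S i k ∷ S (suc k) j ∷ [])
  aggr-rule : ∀ {i j m} → 1 ≤ i → i < j → j ≤ n → m < j ∸ i →
              Rule n (acc i j (suc m)) (acc i j m ∷ comb i (i + m) j ∷ [])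

-- Two-level memory: a cache of M words (a list of the values held, one
-- word each) and an unbounded slow memory (addresses ℕ, each word empty
-- or holding one value).

record Config : Set where
  constructor ⟨_,_⟩
  field
    cache : List Node
    slow  : ℕ → Maybe Node
open Config public

block : (ℕ → Maybe Node) → ℕ → ℕ → List (Maybe Node)
block mem a b = map (λ t → mem (a + t)) (upTo b)

writeBlock : (ℕ → Maybe Node) → ℕ → List Node → (ℕ → Maybe Node)
writeBlock mem a []       = mem
writeBlock mem a (v ∷ vs) x =
  if ⌊ x ≟ a ⌋ then just v else writeBlock mem (suc a) vs x

-- One step of an execution; the ℕ index is its I/O cost (1 for a
-- read/write I/O operation, 0 for a computation or an eviction).
-- Every configuration reached must respect the cache capacity M.
data Step (n M B : ℕ) : Config → ℕ → Config → Set where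
  read    : ∀ {c mem} (a b : ℕ) → 1 ≤ b → b ≤ B →
            length (c ++ catMaybes (block mem a b)) ≤ M →
            Step n M B ⟨ c , mem ⟩ 1 ⟨ c ++ catMaybes (block mem a b) , mem ⟩
  write   : ∀ {c mem} (a : ℕ) (vs : List Node) → 1 ≤ length vs → length vs ≤ B →
            All (_∈ c) vs →
            Step n M B ⟨ c , mem ⟩ 1 ⟨ c , writeBlock mem a vs ⟩
  compute : ∀ {c mem} (v : Node) (ops : List Node) → Rule n v ops →
            All (_∈ c) ops → length (v ∷ c) ≤ M →
            Step n M B ⟨ c , mem ⟩ 0 ⟨ v ∷ c , mem ⟩
  evict   : ∀ {mem} (xs : List Node) (v : Node) (ys : List Node) →
            Step n M B ⟨ xs ++ v ∷ ys , mem ⟩ 0 ⟨ xs ++ ys , mem ⟩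

data Exec (n M B : ℕ) : Config → ℕ → Config → Set where
  done : ∀ {σ} → Exec n M B σ 0 σ
  step : ∀ {σ τ ρ p q} → Step n M B σ p τ → Exec n M B τ q ρ →
         Exec n M B σ (p + q) ρ

initialMem : ℕ → ℕ → Maybe Node
initialMem n a with suc a Data.Nat.≤? n
... | yes _ = just (leaf (suc a))
... | no  _ = nothing

initial : ℕ → Config
initial n = ⟨ [] , initialMem n ⟩

ExecutionOfA* : (n M B io : ℕ) → Set
ExecutionOfA* n M B io =
  ∃[ σ ] (Exec n M B (initial n) io σ × ∃[ a ] (slow σ a ≡ just (S 1 n)))

{-# OPTIONS --safe #-}
module Submission where

-- Read the n inputs with ⌈n/B⌉ block reads, compute S(1,n) inside the cache by
-- recomputing every intermediate value on demand, and write it out.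
--
-- Recomputing S(i,i+d) from its cached inputs needs only d + 2 further words, by
-- induction on d: in the m-th AGGREGATE step the accumulator is kept (1 word), the
-- right operand S(i+m+1,i+d) of the COMBINE is computed first (d − m + 1 more
-- words), and only then the left operand S(i,i+m) (m + 2 more words, beside at
-- most one word holding the right operand, and none when that operand is an
-- input, i.e. when m = d − 1).  For S(1,n) beside the n cached inputs this is one
-- word more than M ≥ 2n allows.  So the outermost loop creates its first COMBINE
-- before its accumulator, and in its last two steps it evicts the input S(n,n)
-- while a long left operand is computed and reads it back with one I/O each.
-- With the final write this makes at most ⌈n/B⌉ + 3 I/Os.

open import Defs
open import Data.Nat
  using (ℕ; zero; suc; _+_; _*_; _∸_; _⊓_; _≤_; _<_; z≤n; s≤s; _≤′_; ≤′-refl; ≤′-step; _≤?_; _≟_)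
open import Data.Nat.Properties
open import Data.Nat.Induction using (<-rec)
open import Data.List using (List; []; _∷_; _++_; [_]; length; applyUpTo; catMaybes)
open import Data.List.Properties
  using (length-++; length-applyUpTo; map-upTo; ++-assoc; ++-identityʳ; applyUpTo-∷ʳ)
open import Data.List.Membership.Propositional using (_∈_)
open import Data.List.Membership.Propositional.Properties using (∈-++⁺ˡ; ∈-++⁺ʳ; ∈-applyUpTo⁺)
open import Data.List.Relation.Unary.All using (All; []; _∷_)
open import Data.List.Relation.Unary.Any using (here; there)
open import Data.Maybe using (Maybe; just)
open import Data.Product using (_×_; _,_; ∃-syntax)
open import Function using (_∘_)
open import Relation.Binary.PropositionalEquality
  using (_≡_; refl; sym; trans; cong; subst; module ≡-Reasoning)
open import Relation.Nullary using (yes; no; contradiction)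

applyUpTo-++ : ∀ {A : Set} (f : ℕ → A) a b →
               applyUpTo f a ++ applyUpTo (f ∘ (a +_)) b ≡ applyUpTo f (a + b)
applyUpTo-++ f zero    b = refl
applyUpTo-++ f (suc a) b = cong (f 0 ∷_) (applyUpTo-++ (f ∘ suc) a b)

catMaybes-applyUpTo : ∀ {A : Set} {f : ℕ → Maybe A} {g : ℕ → A} b →
                      (∀ {t} → t < b → f t ≡ just (g t)) →
                      catMaybes (applyUpTo f b) ≡ applyUpTo g b
catMaybes-applyUpTo zero    _ = refl
catMaybes-applyUpTo {g = g} (suc b) f≡just rewrite f≡just {0} (s≤s z≤n) =
  cong (g 0 ∷_) (catMaybes-applyUpTo b (λ t<b → f≡just (s≤s t<b)))

2≤d⇒1+d⊓1≤d : ∀ {d} → 2 ≤ d → suc (d ⊓ 1) ≤ d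
2≤d⇒1+d⊓1≤d {suc (suc _)} (s≤s (s≤s z≤n)) = s≤s (s≤s z≤n)

S-diag : ∀ i → S i i ≡ leaf i
S-diag i with i ≟ i
... | yes _  = refl
... | no i≢i = contradiction refl i≢i

S-< : ∀ {i j} → i < j → S i j ≡ acc i j (j ∸ i)
S-< {i} {j} i<j with i ≟ j
... | yes refl = contradiction i<j (<-irrefl refl)
... | no _     = refl

inputs : ℕ → List Node
inputs = applyUpTo (leaf ∘ suc)

length-inputs : ∀ k → length (inputs k) ≡ k
length-inputs = length-applyUpTo (leaf ∘ suc)

inputs-∷ʳ : ∀ k → inputs k ++ [ leaf (suc k) ] ≡ inputs (suc k)
inputs-∷ʳ = applyUpTo-∷ʳ (leaf ∘ suc)

LeavesIn : ℕ → ℕ → List Node → Set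
LeavesIn i j c = ∀ {t} → i ≤ t → t ≤ j → leaf t ∈ c

inputs-leaves : ∀ k → LeavesIn 1 k (inputs k)
inputs-leaves k {suc t} _ t<k = ∈-applyUpTo⁺ (leaf ∘ suc) t<k

LeavesIn-⊆ : ∀ {i j i′ j′ c} → i ≤ i′ → j′ ≤ j → LeavesIn i j c → LeavesIn i′ j′ c
LeavesIn-⊆ i≤i′ j′≤j has i′≤t t≤j′ = has (≤-trans i≤i′ i′≤t) (≤-trans t≤j′ j′≤j)

LeavesIn-++ : ∀ {i j c} e → LeavesIn i j c → LeavesIn i j (e ++ c)
LeavesIn-++ e has i≤t t≤j = ∈-++⁺ʳ e (has i≤t t≤j)

fresh : ℕ → ℕ → List Node
fresh i zero    = []
fresh i (suc d) = [ S i (i + suc d) ]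

length-fresh : ∀ i d → length (fresh i d) ≡ d ⊓ 1
length-fresh i zero    = refl
length-fresh i (suc d) = cong suc (sym (⊓-zeroʳ d))

length-fresh-≤ : ∀ i d → length (fresh i d) ≤ d
length-fresh-≤ i zero    = z≤n
length-fresh-≤ i (suc d) = s≤s z≤n

length-fresh-≤1 : ∀ i d → length (fresh i d) ≤ 1
length-fresh-≤1 i zero    = z≤n
length-fresh-≤1 i (suc d) = ≤-refl

fresh-∋ : ∀ i d {c} → LeavesIn i (i + d) c → S i (i + d) ∈ fresh i d ++ c
fresh-∋ i zero    has = subst (_∈ _) (sym (trans (cong (S i) (+-identityʳ i)) (S-diag i)))
                              (has ≤-refl (m≤m+n i 0))
fresh-∋ i (suc d) has = here refl

fresh-head : ∀ {i d c} → 1 ≤ d → S i (i + d) ∈ fresh i d ++ c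
fresh-head {d = suc d} _ = here refl

record Room (M : ℕ) (c : List Node) (k : ℕ) : Set where
  constructor room
  field fits : length c + k ≤ M

room-++ : ∀ {M} e {c k k′} → length e + k ≤ k′ → Room M c k′ → Room M (e ++ c) k
room-++ {M} e {c} {k} {k′} e+k≤k′ (room c+k′≤M) = room (begin
  length (e ++ c) + k        ≡⟨ cong (_+ k) (trans (length-++ e) (+-comm (length e) (length c))) ⟩
  length c + length e + k    ≡⟨ +-assoc (length c) (length e) k ⟩
  length c + (length e + k)  ≤⟨ +-monoʳ-≤ (length c) e+k≤k′ ⟩
  length c + k′              ≤⟨ c+k′≤M ⟩
  M                          ∎)
  where open ≤-Reasoning

room-∷ʳ : ∀ {M c k} v → Room M c (suc k) → Room M (c ++ [ v ]) k
room-∷ʳ {M} {c} {k} v (room fits) =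
  room (subst (_≤ M) (sym (trans (cong (_+ k) (length-++ c)) (+-assoc (length c) 1 k))) fits)

room-inputs : ∀ {M k x} → k + x ≤ M → Room M (inputs k) x
room-inputs {M} {k} {x} k+x≤M = room (subst (_≤ M) (sym (cong (_+ x) (length-inputs k))) k+x≤M)

initialMem-input : ∀ {n a} → a < n → initialMem n a ≡ just (leaf (suc a))
initialMem-input {n} {a} a<n with suc a ≤? n
... | yes _   = refl
... | no  a≮n = contradiction a<n a≮n

block-initialMem : ∀ {n a b} → a + b ≤ n →
                   catMaybes (block (initialMem n) a b) ≡ applyUpTo (λ t → leaf (suc (a + t))) b
block-initialMem {n} {a} {b} a+b≤n = begin
  catMaybes (block (initialMem n) a b)
    ≡⟨ cong catMaybes (map-upTo (λ t → initialMem n (a + t)) b) ⟩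
  catMaybes (applyUpTo (λ t → initialMem n (a + t)) b)
    ≡⟨ catMaybes-applyUpTo b (λ t<b → initialMem-input (<-≤-trans (+-monoʳ-< a t<b) a+b≤n)) ⟩
  applyUpTo (λ t → leaf (suc (a + t))) b ∎
  where open ≡-Reasoning

infixr 5 _▸_
_▸_ : ∀ {n M B σ τ ρ p q} → Exec n M B σ p τ → Exec n M B τ q ρ → Exec n M B σ (p + q) ρ
done ▸ e′ = e′
_▸_ {n} {M} {B} {σ} {ρ = ρ} (step {p = p} {q} s e) e′ =
  subst (λ k → Exec n M B σ k ρ) (sym (+-assoc p q _)) (step s (e ▸ e′))

cache-≡ : ∀ {n M B σ k c c′ mem} → c ≡ c′ →
          Exec n M B σ k ⟨ c , mem ⟩ → Exec n M B σ k ⟨ c′ , mem ⟩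
cache-≡ refl e = e

module Recompute (n M B : ℕ) (mem : ℕ → Maybe Node) where

  infix 4 _⇒_
  _⇒_ : List Node → List Node → Set
  c ⇒ c′ = Exec n M B ⟨ c , mem ⟩ 0 ⟨ c′ , mem ⟩

  reshape : ∀ {c c′} → c ≡ c′ → c ⇒ c′
  reshape refl = done

  compute₁ : ∀ {v ops c} → Rule n v ops → All (_∈ c) ops → Room M c 1 → c ⇒ v ∷ c
  compute₁ {c = c} rule ops∈c (room fits) =
    step (compute _ _ rule ops∈c (subst (_≤ M) (+-comm (length c) 1) fits)) done

  discard : ∀ v e c → v ∷ e ++ c ⇒ v ∷ c
  discard v []      c = done
  discard v (x ∷ e) c = step (evict [ v ] x (e ++ c)) (discard v e c)

  evict-last : ∀ c v → c ++ [ v ] ⇒ c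
  evict-last c v = step (evict c v []) (reshape (++-identityʳ c))

  iterate : ∀ (f : ℕ → List Node) {a b} → (∀ {m} → a ≤ m → m < b → f m ⇒ f (suc m)) →
            a ≤ b → f a ⇒ f b
  iterate f {a} next a≤b = go next (≤⇒≤′ a≤b)
    where
    go : ∀ {b} → (∀ {m} → a ≤ m → m < b → f m ⇒ f (suc m)) → a ≤′ b → f a ⇒ f b
    go next ≤′-refl        = done
    go next (≤′-step a≤′b) =
      go (λ a≤m m<b → next a≤m (m<n⇒m<1+n m<b)) a≤′b ▸ next (≤′⇒≤ a≤′b) ≤-refl

  Obtainer : ℕ → ℕ → Set
  Obtainer i d = ∀ {c} → LeavesIn i (i + d) c → Room M c (2 + d) → c ⇒ fresh i d ++ c

  aggregate : ∀ {i j m c} → 1 ≤ i → i < j → j ≤ n → m < j ∸ i → Room M c 3 →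
              comb i (i + m) j ∷ acc i j m ∷ c ⇒ acc i j (suc m) ∷ c
  aggregate 1≤i i<j j≤n m<j∸i fits =
    compute₁ (aggr-rule 1≤i i<j j≤n m<j∸i) (there (here refl) ∷ here refl ∷ [])
             (room-++ (_ ∷ _ ∷ []) ≤-refl fits)
    ▸ discard _ (_ ∷ _ ∷ []) _

  combine-left : ∀ {i dl j e c} → 1 ≤ i → suc (i + dl) ≤ j → j ≤ n → Obtainer i dl →
                 LeavesIn i (i + dl) c → S (suc (i + dl)) j ∈ e ++ c →
                 Room M (e ++ c) (2 + dl) → e ++ c ⇒ comb i (i + dl) j ∷ c
  combine-left {i} {dl} {e = e} {c} 1≤i k<j j≤n left has right∈ fits =
    left (LeavesIn-++ e has) fits
    ▸ compute₁ (comb-rule 1≤i (m≤m+n i dl) k<j j≤n)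
               (fresh-∋ i dl (LeavesIn-++ e has) ∷ ∈-++⁺ʳ (fresh i dl) right∈ ∷ [])
               (room-++ (fresh i dl) fresh+1≤ fits)
    ▸ discard _ (fresh i dl) (e ++ c) ▸ discard _ e c
    where
    fresh+1≤ : length (fresh i dl) + 1 ≤ 2 + dl
    fresh+1≤ = ≤-trans (+-monoˡ-≤ 1 (length-fresh-≤1 i dl)) (m≤m+n 2 dl)

  combine : ∀ {i dl dr j c} → 1 ≤ i → suc (i + dl) + dr ≡ j → j ≤ n →
            Obtainer i dl → Obtainer (suc (i + dl)) dr → LeavesIn i j c →
            Room M c (2 + dr) → Room M c (2 + dl + dr ⊓ 1) →
            c ⇒ comb i (i + dl) j ∷ c
  combine {i} {dl} {dr} {c = c} 1≤i refl j≤n left right has fitsʳ fitsˡ =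
    right hasʳ fitsʳ
    ▸ combine-left 1≤i (m≤m+n _ dr) j≤n left
        (LeavesIn-⊆ ≤-refl (m≤n⇒m≤1+n (m≤m+n (i + dl) dr)) has)
        (fresh-∋ (suc (i + dl)) dr hasʳ)
        (room-++ (fresh (suc (i + dl)) dr) fresh+dl≤ fitsˡ)
    where
    hasʳ : LeavesIn (suc (i + dl)) (suc (i + dl) + dr) c
    hasʳ = LeavesIn-⊆ (m≤n⇒m≤1+n (m≤m+n i dl)) ≤-refl has
    fresh+dl≤ : length (fresh (suc (i + dl)) dr) + (2 + dl) ≤ 2 + dl + dr ⊓ 1
    fresh+dl≤ = ≤-reflexive (trans (cong (_+ (2 + dl)) (length-fresh _ dr)) (+-comm (dr ⊓ 1) (2 + dl)))

  Obtainable : ℕ → Set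
  Obtainable d = ∀ {i} → 1 ≤ i → i + d ≤ n → Obtainer i d

  obtain : ∀ d → Obtainable d
  obtain = <-rec Obtainable obtain-by
    where
    obtain-by : ∀ d → (∀ {d′} → d′ < d → Obtainable d′) → Obtainable d
    obtain-by zero    _   _ _ _ _ = done
    obtain-by (suc d) rec {i} 1≤i j≤n {c} has fits =
      compute₁ (init-rule 1≤i i<j j≤n) [] (room-++ [] (s≤s z≤n) fits)
      ▸ iterate (λ m → acc i j m ∷ c) advance z≤n
      ▸ reshape (cong (_∷ c) (sym S≡acc))
      where
      j = i + suc d
      i<j : i < j
      i<j = m<m+n i (s≤s z≤n)
      j∸i : j ∸ i ≡ suc d
      j∸i = m+n∸m≡n i (suc d)
      S≡acc : S i j ≡ acc i j (suc d)
      S≡acc = trans (S-< i<j) (cong (acc i j) j∸i)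
      advance : ∀ {m} → 0 ≤ m → m < suc d → acc i j m ∷ c ⇒ acc i j (suc m) ∷ c
      advance {m} _ (s≤s m≤d) =
        combine 1≤i split j≤n
                (rec (s≤s m≤d) 1≤i (≤-trans (+-monoʳ-≤ i (m≤n⇒m≤1+n m≤d)) j≤n))
                (rec (s≤s (m∸n≤m d m)) (s≤s z≤n) (≤-trans (≤-reflexive split) j≤n))
                (LeavesIn-++ [ _ ] has)
                (room-++ [ _ ] (s≤s (s≤s (s≤s (m∸n≤m d m)))) fits)
                (room-++ [ _ ] (s≤s (s≤s (s≤s m+r⊓1≤d))) fits)
        ▸ aggregate 1≤i i<j j≤n (subst (m <_) (sym j∸i) (s≤s m≤d))
                    (room-++ [] (s≤s (s≤s (s≤s z≤n))) fits)
        where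
        r = d ∸ m
        split : suc (i + m) + r ≡ j
        split = begin
          suc (i + m) + r    ≡⟨ cong suc (+-assoc i m r) ⟩
          suc (i + (m + r))  ≡⟨ cong (λ x → suc (i + x)) (m+[n∸m]≡n m≤d) ⟩
          suc (i + d)        ≡⟨ sym (+-suc i d) ⟩
          j                  ∎
          where open ≡-Reasoning
        m+r⊓1≤d : m + r ⊓ 1 ≤ d
        m+r⊓1≤d = ≤-trans (+-monoʳ-≤ m (m⊓n≤m r 1)) (≤-reflexive (m+[n∸m]≡n m≤d))

read-inputs-at : ∀ {n M B} c {a b} → 1 ≤ b → b ≤ B → a + b ≤ n → Room M c b →
                 Exec n M B ⟨ c , initialMem n ⟩ 1
                            ⟨ c ++ applyUpTo (λ t → leaf (suc (a + t))) b , initialMem n ⟩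
read-inputs-at {n} {M} c {a} {b} 1≤b b≤B a+b≤n (room fits) =
  cache-≡ (cong (c ++_) fetched) (step (read a b 1≤b b≤B fits′) done)
  where
  fetched = block-initialMem a+b≤n
  fits′ : length (c ++ catMaybes (block (initialMem n) a b)) ≤ M
  fits′ = subst (_≤ M) (sym (trans (length-++ c)
            (cong (length c +_) (trans (cong length fetched) (length-applyUpTo _ b))))) fits

read-block : ∀ {n M B a b} → 1 ≤ b → b ≤ B → a + b ≤ n → Room M (inputs a) b →
             Exec n M B ⟨ inputs a , initialMem n ⟩ 1 ⟨ inputs (a + b) , initialMem n ⟩
read-block {a = a} {b} 1≤b b≤B a+b≤n fits =
  cache-≡ (applyUpTo-++ (leaf ∘ suc) a b) (read-inputs-at (inputs a) 1≤b b≤B a+b≤n fits)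

read-input : ∀ {n M B} c {a} → a < n → 1 ≤ B → Room M c 1 →
             Exec n M B ⟨ c , initialMem n ⟩ 1 ⟨ c ++ [ leaf (suc a) ] , initialMem n ⟩
read-input {n} c {a} a<n 1≤B fits =
  cache-≡ (cong (λ t → c ++ [ leaf (suc t) ]) (+-identityʳ a))
          (read-inputs-at c ≤-refl 1≤B (subst (_≤ n) (+-comm 1 a) a<n) fits)

read-inputs : ∀ {n M B} → 1 ≤ B → n ≤ M →
              ∃[ r ] (r * B ≤ n + B × Exec n M B (initial n) r ⟨ inputs n , initialMem n ⟩)
read-inputs {n} {M} {B} 1≤B n≤M = <-rec Readable read-rest n 0 refl
  where
  Readable : ℕ → Set
  Readable k = ∀ a → a + k ≡ n →
    ∃[ r ] (r * B ≤ k + B × Exec n M B ⟨ inputs a , initialMem n ⟩ r ⟨ inputs n , initialMem n ⟩)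
  read-rest : ∀ k → (∀ {k′} → k′ < k → Readable k′) → Readable k
  read-rest zero _ a a+0≡n =
    0 , z≤n , cache-≡ (cong inputs (trans (sym (+-identityʳ a)) a+0≡n)) done
  read-rest k@(suc _) rec a a+k≡n with k ≤? B
  ... | yes k≤B =
    1 , ≤-trans (≤-reflexive (+-identityʳ B)) (m≤n+m B k) ,
    cache-≡ (cong inputs a+k≡n)
      (read-block (s≤s z≤n) k≤B (≤-reflexive a+k≡n) (room-inputs (≤-trans (≤-reflexive a+k≡n) n≤M)))
  ... | no k≰B =
    let B≤k = <⇒≤ (≰⇒> k≰B)
        a+B≤n = ≤-trans (+-monoʳ-≤ a B≤k) (≤-reflexive a+k≡n)
        r , r*B≤ , rest = rec (∸-monoʳ-< 1≤B B≤k) (a + B)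
                            (trans (+-assoc a B (k ∸ B)) (trans (cong (a +_) (m+[n∸m]≡n B≤k)) a+k≡n))
    in suc r ,
       (begin
         B + r * B        ≤⟨ +-monoʳ-≤ B r*B≤ ⟩
         B + (k ∸ B + B)  ≡⟨ cong (B +_) (m∸n+n≡m B≤k) ⟩
         B + k            ≡⟨ +-comm B k ⟩
         k + B            ∎) ,
       (read-block 1≤B ≤-refl a+B≤n (room-inputs (≤-trans a+B≤n n≤M)) ▸ rest)
    where open ≤-Reasoning

Completion : (n M B : ℕ) → Config → ℕ → Set
Completion n M B σ k = ∃[ τ ] (Exec n M B σ k τ × ∃[ a ] (slow τ a ≡ just (S 1 n)))

prepend : ∀ {n M B σ τ p k} → Exec n M B σ p τ → Completion n M B τ k → Completion n M B σ (p + k)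
prepend e (τ , e′ , stored) = τ , e ▸ e′ , stored

module Schedule (q M B : ℕ) (2n≤M : 2 * (2 + q) ≤ M) (1≤B : 1 ≤ B) where

  n : ℕ
  n = 2 + q

  open Recompute n M B (initialMem n)

  n+n≤M : n + n ≤ M
  n+n≤M = ≤-trans (≤-reflexive (cong (n +_) (sym (+-identityʳ n)))) 2n≤M

  room-n : Room M (inputs n) n
  room-n = room-inputs n+n≤M

  room-1+q : Room M (inputs (1 + q)) (3 + q)
  room-1+q = room-inputs (subst (_≤ M) (sym (cong suc (+-suc q (2 + q)))) n+n≤M)

  room-right : ∀ {x m} → 1 ≤ m → m ≤ q → Room M (x ∷ inputs n) (2 + (q ∸ m))
  room-right {m = m} 1≤m m≤q =
    room-++ [ _ ] (s≤s (s≤s (≤-trans (+-monoˡ-≤ (q ∸ m) 1≤m) (≤-reflexive (m+[n∸m]≡n m≤q))))) room-n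

  split : ∀ {m} → m ≤ q → suc (1 + m) + (q ∸ m) ≡ n
  split m≤q = cong (2 +_) (m+[n∸m]≡n m≤q)

  release : ∀ {x} e → e ++ x ∷ inputs n ⇒ e ++ x ∷ inputs (1 + q)
  release {x} e =
    reshape (trans (cong (λ xs → e ++ x ∷ xs) (sym (inputs-∷ʳ (1 + q))))
                   (sym (++-assoc e (x ∷ inputs (1 + q)) [ leaf n ])))
    ▸ evict-last _ _

  reread : ∀ {x} → Exec n M B ⟨ x ∷ inputs (1 + q) , initialMem n ⟩ 1 ⟨ x ∷ inputs n , initialMem n ⟩
  reread {x} = read-input (x ∷ inputs (1 + q)) ≤-refl 1≤B (room-++ [ x ] (s≤s (s≤s z≤n)) room-1+q)
               ▸ reshape (cong (x ∷_) (inputs-∷ʳ (1 + q)))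

  start : inputs n ⇒ acc 1 n 0 ∷ inputs n
  start = compute₁ (init-rule ≤-refl (s≤s (s≤s z≤n)) ≤-refl) [] (room-++ [] (s≤s z≤n) room-n)

  opening : 1 ≤ q → inputs n ⇒ acc 1 n 1 ∷ inputs n
  opening 1≤q =
    combine ≤-refl refl ≤-refl (obtain 0 ≤-refl (s≤s z≤n)) (obtain q (s≤s z≤n) ≤-refl)
            (inputs-leaves n) (room-++ [] ≤-refl room-n)
            (room-++ [] (s≤s (s≤s (m⊓n≤m q 1))) room-n)
    ▸ compute₁ (init-rule ≤-refl (s≤s (s≤s z≤n)) ≤-refl) [] (room-++ [ _ ] (s≤s (s≤s z≤n)) room-n)
    ▸ compute₁ (aggr-rule ≤-refl (s≤s (s≤s z≤n)) ≤-refl (s≤s z≤n)) (here refl ∷ there (here refl) ∷ [])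
               (room-++ (_ ∷ _ ∷ []) (s≤s (s≤s 1≤q)) room-n)
    ▸ discard _ (_ ∷ _ ∷ []) _

  in-cache-step : ∀ {m} → 1 ≤ m → 2 + m ≤ q → acc 1 n m ∷ inputs n ⇒ acc 1 n (suc m) ∷ inputs n
  in-cache-step {m} 1≤m 2+m≤q =
    combine ≤-refl (split m≤q) ≤-refl
            (obtain m ≤-refl (s≤s (m≤n⇒m≤1+n m≤q))) (obtain r (s≤s z≤n) (≤-reflexive (split m≤q)))
            (LeavesIn-++ [ _ ] (inputs-leaves n)) (room-right 1≤m m≤q)
            (room-++ [ _ ] (s≤s (s≤s 1+m+r⊓1≤q)) room-n)
    ▸ aggregate ≤-refl (s≤s (s≤s z≤n)) ≤-refl (s≤s m≤q)
                (room-++ [] (s≤s (s≤s (≤-trans 1≤m m≤q))) room-n)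
    where
    m≤q = ≤-trans (m≤n+m m 2) 2+m≤q
    r = q ∸ m
    1+m+r⊓1≤q : suc (m + r ⊓ 1) ≤ q
    1+m+r⊓1≤q = begin
      suc (m + r ⊓ 1)  ≡⟨ sym (+-suc m (r ⊓ 1)) ⟩
      m + suc (r ⊓ 1)  ≤⟨ +-monoʳ-≤ m (2≤d⇒1+d⊓1≤d (m+n≤o⇒m≤o∸n 2 2+m≤q)) ⟩
      m + r            ≡⟨ m+[n∸m]≡n m≤q ⟩
      q                ∎
      where open ≤-Reasoning

  reread-step : ∀ {m} → 1 ≤ m → m < q →
                Exec n M B ⟨ acc 1 n m ∷ inputs n , initialMem n ⟩ 1
                           ⟨ acc 1 n (suc m) ∷ inputs n , initialMem n ⟩
  reread-step {m} 1≤m m<q =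
    obtain r (s≤s z≤n) (≤-reflexive (split m≤q))
           (LeavesIn-⊆ (s≤s z≤n) (≤-reflexive (split m≤q)) (LeavesIn-++ [ _ ] (inputs-leaves n)))
           (room-right 1≤m m≤q)
    ▸ release (fresh (2 + m) r)
    ▸ combine-left ≤-refl (s≤s (s≤s m≤q)) ≤-refl (obtain m ≤-refl (s≤s (m≤n⇒m≤1+n m≤q)))
        (LeavesIn-++ [ _ ] (LeavesIn-⊆ ≤-refl (s≤s m≤q) (inputs-leaves (1 + q))))
        (subst (λ j → S (2 + m) j ∈ fresh (2 + m) r ++ acc 1 n m ∷ inputs (1 + q)) (split m≤q)
               (fresh-head (m+n≤o⇒m≤o∸n 1 m<q)))
        (room-++ (fresh (2 + m) r) (+-monoˡ-≤ (2 + m) (length-fresh-≤1 (2 + m) r))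
          (room-++ [ _ ] (s≤s (s≤s (s≤s m<q))) room-1+q))
    ▸ aggregate ≤-refl (s≤s (s≤s z≤n)) ≤-refl (s≤s m≤q) (room-++ [] (s≤s (s≤s (s≤s z≤n))) room-1+q)
    ▸ reread
    where
    m≤q = <⇒≤ m<q
    r = q ∸ m

  finish : Completion n M B ⟨ acc 1 n q ∷ inputs n , initialMem n ⟩ 2
  finish = _ ,
    (release []
     ▸ obtain q ≤-refl (s≤s (n≤1+n q)) has (room-++ [ _ ] ≤-refl room-1+q)
     ▸ read-input (fresh 1 q ++ _) ≤-refl 1≤B
         (room-++ (fresh 1 q) (≤-trans (+-monoˡ-≤ 1 (length-fresh-≤1 1 q)) (s≤s (s≤s z≤n)))
            (room-++ [ _ ] ≤-refl room-1+q))
     ▸ compute₁ (comb-rule ≤-refl (s≤s z≤n) ≤-refl ≤-refl)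
         (∈-++⁺ˡ (fresh-∋ 1 q has) ∷ ∈-++⁺ʳ (fresh 1 q ++ _) (here (S-diag n)) ∷ [])
         (room-∷ʳ (leaf n) (room-++ (fresh 1 q)
            (≤-trans (+-monoˡ-≤ 2 (length-fresh-≤ 1 q)) (≤-reflexive (+-comm q 2)))
            (room-++ [ _ ] ≤-refl room-1+q)))
     ▸ evict-last (comb 1 (1 + q) n ∷ fresh 1 q ++ _) (leaf n)
     ▸ discard _ (fresh 1 q) _
     ▸ aggregate ≤-refl (s≤s (s≤s z≤n)) ≤-refl ≤-refl (room-++ [] (s≤s (s≤s (s≤s z≤n))) room-1+q)
     ▸ step (write 0 [ acc 1 n (suc q) ] ≤-refl 1≤B (here refl ∷ [])) done) ,
    0 , refl
    where
    has : LeavesIn 1 (1 + q) (acc 1 n q ∷ inputs (1 + q))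
    has = LeavesIn-++ [ _ ] (inputs-leaves (1 + q))

complete-from-inputs : ∀ q {M B} → 2 * (2 + q) ≤ M → 1 ≤ B →
  ∃[ k ] (k ≤ 3 × Completion (2 + q) M B ⟨ inputs (2 + q) , initialMem (2 + q) ⟩ k)
complete-from-inputs zero {M} {B} 2n≤M 1≤B = 2 , n≤1+n 2 , prepend start finish
  where open Schedule 0 M B 2n≤M 1≤B
complete-from-inputs (suc zero) {M} {B} 2n≤M 1≤B = 2 , n≤1+n 2 , prepend (opening ≤-refl) finish
  where open Schedule 1 M B 2n≤M 1≤B
complete-from-inputs (suc (suc r)) {M} {B} 2n≤M 1≤B =
  3 , ≤-refl ,
  prepend (opening (s≤s z≤n)
           ▸ iterate (λ m → acc 1 n m ∷ inputs n)
                     (λ 1≤m m<1+r → in-cache-step 1≤m (s≤s (s≤s (≤-pred m<1+r)))) (s≤s z≤n)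
           ▸ reread-step (s≤s z≤n) ≤-refl)
          finish
  where open Schedule (suc (suc r)) M B 2n≤M 1≤B
        open Recompute n M B (initialMem n)

io-bound : ∀ n r {B k} → r * B ≤ n + B → k ≤ 3 → (r + k) * B ≤ 4 * (n + B)
io-bound n r {B} {k} r*B≤ k≤3 = begin
  (r + k) * B            ≡⟨ *-distribʳ-+ B r k ⟩
  r * B + k * B          ≤⟨ +-mono-≤ r*B≤ (*-monoˡ-≤ B k≤3) ⟩
  (n + B) + 3 * B        ≤⟨ +-monoʳ-≤ (n + B) (*-monoʳ-≤ 3 (m≤n+m B n)) ⟩
  (n + B) + 3 * (n + B)  ∎
  where open ≤-Reasoning

theorem7 : ∃[ c ] ((n M B : ℕ) → 1 ≤ n → 1 ≤ B → 2 * n ≤ M →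
    ∃[ io ] (ExecutionOfA* n M B io × io * B ≤ c * (n + B)))
theorem7 = 4 , solve
  where
  solve : (n M B : ℕ) → 1 ≤ n → 1 ≤ B → 2 * n ≤ M →
          ∃[ io ] (ExecutionOfA* n M B io × io * B ≤ 4 * (n + B))
  -- For n = 1 the output S(1,1) is the input itself, already stored at address 0.
  solve 1 M B _ _ _ = 0 , (initial 1 , done , 0 , refl) , z≤n
  solve n@(suc (suc q)) M B _ 1≤B 2n≤M
    with read-inputs 1≤B (≤-trans (m≤m+n n (n + 0)) 2n≤M) | complete-from-inputs q 2n≤M 1≤B
  ... | r , r*B≤ , reading | k , k≤3 , completion =
    r + k , prepend reading completion , io-bound n r r*B≤ k≤3
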